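{- Let $S$ be a non special numerical semigroup and $T=\mathcal{A}(S)$. If there exists a gap $x\in\mathbb{N}\setminus S$ with $\operatorname{F}(S)-\operatorname{m}(S)+1\le x<\operatorname{F}(S)$, then $\operatorname{e}(T)\ge\operatorname{e}(S)$.
   Context: $\mathbb{N}=\{0,1,2,\ldots\}$. A numerical semigroup is a submonoid $S$ of $(\mathbb{N},+)$ with $\mathbb{N}\setminus S$ finite; $\operatorname{e}(S)$ is the number of minimal generators of $S$ (elements of $S\setminus\{0\}$ not expressible as a sum of two elements of $S\setminus\{0\}$). $\operatorname{H}(S)=\mathbb{N}\setminus S$; $\operatorname{F}(S)=\max\operatorname{H}(S)$; $\operatorname{m}(S)=\min(S\setminus\{0\})$. Special gaps: $\operatorname{SG}(S)=\{h\in\operatorname{H}(S)\mid 2h\in S \text{ and } h+s\in S \text{ for all } s\in S\setminus\{0\}\}$. $S$ is special if there is no $h\in\operatorname{SG}(S)\setminus\{\operatorname{F}(S)\}$ with $h>\operatorname{m}(S)$. For non special $S$, $\mathcal{A}(S)=(S\cup\{h\})\setminus\{\operatorname{m}(S)\}$ with $h=\max(\operatorname{SG}(S)\setminus\{\operatorname{F}(S)\})$. -}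

module Defs where

open import Data.Nat using (ℕ; _+_; _<_; _≤_)
open import Data.Product using (Σ; ∃; _×_)
open import Data.Sum using (_⊎_)
open import Data.List using (List; length)
open import Data.List.Membership.Propositional using (_∈_)
open import Data.List.Relation.Unary.Unique.Propositional using (Unique)
open import Relation.Binary.PropositionalEquality using (_≡_; _≢_)
open import Relation.Nullary using (¬_)

Subset : Set₁
Subset = ℕ → Set

record IsNumericalSemigroup (S : Subset) : Set where
  field
    zero∈ : S 0
    closed : ∀ a b → S a → S b → S (a + b)
    cofinite : ∃ λ N → ∀ n → N ≤ n → S n

MinimalGenerator : Subset → ℕ → Set
MinimalGenerator S x =
  S x × x ≢ 0 ×
  ¬ (∃ λ a → ∃ λ b → S a × a ≢ 0 × S b × b ≢ 0 × a + b ≡ x)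

IsEmbeddingDimension : Subset → ℕ → Set
IsEmbeddingDimension S k =
  Σ (List ℕ) λ gs → Unique gs × length gs ≡ k ×
    (∀ x → (x ∈ gs → MinimalGenerator S x) × (MinimalGenerator S x → x ∈ gs))

IsFrobenius : Subset → ℕ → Set
IsFrobenius S f = ¬ S f × (∀ n → f < n → S n)

IsMultiplicity : Subset → ℕ → Set
IsMultiplicity S m = S m × m ≢ 0 × (∀ n → S n → n ≢ 0 → m ≤ n)

SpecialGap : Subset → ℕ → Set
SpecialGap S h = ¬ S h × S (h + h) × (∀ s → S s → s ≢ 0 → S (h + s))

IsMax : (ℕ → Set) → ℕ → Set
IsMax P h = P h × (∀ y → P y → y ≤ h)

IsSpecial : Subset → (f m : ℕ) → Set
IsSpecial S f m = ¬ (∃ λ h → SpecialGap S h × h ≢ f × m < h)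

A : Subset → (h m : ℕ) → Subset
A S h m x = (S x ⊎ x ≡ h) × x ≢ m

{-# OPTIONS --safe #-}
module Submission where

-- Let h be the largest special gap other than f; non-speciality gives m < h. Doubling a gap of S
-- in (f - m, f) yields either a special gap (hence at most h) or another gap in that window, so
-- the window gap forces f < h + m, and then f is the only gap of S above h. Consequently a minimal
-- generator g of S stays minimal in T = (S ∪ {h}) \ {m} unless g = m or g = f + m, while h and 2m
-- are minimal generators of T; sending m ↦ 2m, f + m ↦ h and fixing the rest injects the minimal
-- generators of S into those of T.

open import Defs
open import Data.Nat using (ℕ; _+_; _∸_; _<_; _≤_; _≟_; _<?_; _≤?_; z≤n; s≤s)
open import Data.Nat.Properties
open import Data.Nat.Induction using (<-wellFounded)
open import Data.Product using (∃; _×_; _,_; proj₁; proj₂)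
open import Data.Sum using (inj₁; inj₂)
open import Data.Empty using (⊥; ⊥-elim)
open import Data.List using (List; []; _∷_; length)
open import Data.List.Properties using (length-removeAt′)
open import Data.List.Membership.Propositional using (_∈_)
open import Data.List.Relation.Unary.Any using (here; there; _─_)
open import Data.List.Relation.Unary.All as All using ()
open import Data.List.Relation.Unary.AllPairs using (_∷_)
open import Data.List.Relation.Unary.Unique.Propositional using (Unique)
open import Induction.WellFounded using (Acc; acc)
open import Relation.Binary.PropositionalEquality
  using (_≡_; _≢_; refl; sym; trans; cong; subst; ≢-sym; module ≡-Reasoning)
open import Relation.Nullary using (¬_; yes; no)
open import Relation.Nullary.Decidable using (decidable-stable)

∈-─ : ∀ {A : Set} {x y : A} {xs : List A} (x∈xs : x ∈ xs) → y ∈ xs → y ≢ x → y ∈ (xs ─ x∈xs)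
∈-─ (here refl)  (here refl)  y≢x = ⊥-elim (y≢x refl)
∈-─ (here _)     (there y∈xs) _   = y∈xs
∈-─ (there _)    (here y≡z)   _   = here y≡z
∈-─ (there x∈xs) (there y∈xs) y≢x = there (∈-─ x∈xs y∈xs y≢x)

Unique-injection⇒length≤ : ∀ {A B : Set} (φ : A → B) {xs : List A} {ys : List B} → Unique xs →
  (∀ {x} → x ∈ xs → φ x ∈ ys) →
  (∀ {x x′} → x ∈ xs → x′ ∈ xs → φ x ≡ φ x′ → x ≡ x′) →
  length xs ≤ length ys
Unique-injection⇒length≤ φ {[]} _ _ _ = z≤n
Unique-injection⇒length≤ φ {x ∷ xs} {ys} (x∉xs ∷ unique) maps inj =
  subst (length (x ∷ xs) ≤_) (sym (length-removeAt′ ys _))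
    (s≤s (Unique-injection⇒length≤ φ unique maps′ (λ p q → inj (there p) (there q))))
  where
  maps′ : ∀ {x′} → x′ ∈ xs → φ x′ ∈ (ys ─ maps (here refl))
  maps′ x′∈xs = ∈-─ (maps (here refl)) (maps (there x′∈xs))
    (λ φx′≡φx → All.lookup x∉xs x′∈xs (inj (here refl) (there x′∈xs) (sym φx′≡φx)))

Decomposable : Subset → ℕ → Set
Decomposable U g = ∃ λ a → ∃ λ b → U a × a ≢ 0 × U b × b ≢ 0 × a + b ≡ g

f∸m+1≤x⇒f<x+m : ∀ {f m x} → f ∸ m + 1 ≤ x → f < x + m
f∸m+1≤x⇒f<x+m {f} {m} {x} f∸m+1≤x = begin-strict
  f           ≤⟨ m≤n+m∸n f m ⟩
  m + (f ∸ m) <⟨ +-monoʳ-< m (subst (_≤ x) (+-comm (f ∸ m) 1) f∸m+1≤x) ⟩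
  m + x       ≡⟨ +-comm m x ⟩
  x + m       ∎
  where open ≤-Reasoning

module _ {S : Subset} (ns : IsNumericalSemigroup S) {f m : ℕ}
         (frob : IsFrobenius S f) (mult : IsMultiplicity S m) where

  open IsNumericalSemigroup ns

  private
    Sm : S m
    Sm = proj₁ mult
    m≢0 : m ≢ 0
    m≢0 = proj₁ (proj₂ mult)
    m≤ : ∀ s → S s → s ≢ 0 → m ≤ s
    m≤ = proj₂ (proj₂ mult)
    above-f : ∀ n → f < n → S n
    above-f = proj₂ frob

  gap⇒≢0 : ∀ {z} → ¬ S z → z ≢ 0
  gap⇒≢0 gz refl = gz zero∈

  f<z+m⇒absorbs : ∀ {z} → f < z + m → ∀ s → S s → s ≢ 0 → S (z + s)
  f<z+m⇒absorbs {z} f<z+m s Ss s≢0 = above-f (z + s) (<-≤-trans f<z+m (+-monoʳ-≤ z (m≤ s Ss s≢0)))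

  module _ {h : ℕ} (hmax : IsMax (λ y → SpecialGap S y × y ≢ f) h) (m<h : m < h) where

    private
      gh : ¬ S h
      gh = proj₁ (proj₁ (proj₁ hmax))
      ≤h : ∀ z → SpecialGap S z × z ≢ f → z ≤ h
      ≤h = proj₂ hmax

    T : Subset
    T = A S h m

    -- Doubling a gap z with f - m < z < f gives another such gap unless f < h + m.
    no-window-gap : h + m ≤ f → ∀ z → Acc _<_ (f ∸ z) → ¬ S z → f < z + m → z < f → ⊥
    no-window-gap h+m≤f z (acc rs) gz f<z+m z<f =
      no-window-gap h+m≤f (z + z) (rs shrink) g2z f<2z+m 2z<f
      where
      g2z : ¬ S (z + z)
      g2z S2z = <⇒≱ (<-≤-trans f<z+m (+-monoˡ-≤ m (≤h z ((gz , S2z , f<z+m⇒absorbs f<z+m) , <⇒≢ z<f))))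
                    h+m≤f
      2z≤f : z + z ≤ f
      2z≤f = ≮⇒≥ (λ f<2z → g2z (above-f _ f<2z))
      2z≢f : z + z ≢ f
      2z≢f 2z≡f = <⇒≱ (begin-strict
          f     ≡⟨ sym 2z≡f ⟩
          z + z <⟨ +-mono-< z<m z<m ⟩
          m + m ≤⟨ +-monoˡ-≤ m (<⇒≤ m<h) ⟩
          h + m ∎) h+m≤f
        where
        open ≤-Reasoning
        z<m : z < m
        z<m = +-cancelˡ-< z z m (subst (_< z + m) (sym 2z≡f) f<z+m)
      2z<f : z + z < f
      2z<f = ≤∧≢⇒< 2z≤f 2z≢f
      f<2z+m : f < z + z + m
      f<2z+m = <-≤-trans f<z+m (+-monoˡ-≤ m (m≤m+n z z))
      shrink : f ∸ (z + z) < f ∸ z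
      shrink = ∸-monoʳ-< (m<m+n z (n≢0⇒n>0 (gap⇒≢0 gz))) 2z≤f

    window-gap⇒f<h+m : ∀ {x} → ¬ S x → f < x + m → x < f → f < h + m
    window-gap⇒f<h+m {x} gx f<x+m x<f = decidable-stable (f <? h + m)
      (λ f≮h+m → no-window-gap (≮⇒≥ f≮h+m) x (<-wellFounded (f ∸ x)) gx f<x+m x<f)

    module _ (f<h+m : f < h + m) where

      gap>h⇒≡f : ∀ {g} → ¬ S g → h < g → g ≡ f
      gap>h⇒≡f {g} gg h<g with g ≟ f
      ... | yes g≡f = g≡f
      ... | no g≢f = ⊥-elim (<⇒≱ h<g (≤h g ((gg , S2g , f<z+m⇒absorbs f<g+m) , g≢f)))
        where
        f<g+m : f < g + m
        f<g+m = <-≤-trans f<h+m (+-monoˡ-≤ m (<⇒≤ h<g))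
        S2g : S (g + g)
        S2g = above-f (g + g) (<-≤-trans f<g+m (+-monoʳ-≤ g (<⇒≤ (<-trans m<h h<g))))

      T-nonzero⇒m< : ∀ {b} → T b → b ≢ 0 → m < b
      T-nonzero⇒m< (inj₁ Sb , b≢m) b≢0 = ≤∧≢⇒< (m≤ _ Sb b≢0) (λ m≡b → b≢m (sym m≡b))
      T-nonzero⇒m< (inj₂ refl , _) _ = m<h

      -- If g = h + b then g = m + c with c = h + (b - m) > h, and c must be the gap f.
      h+T≡indecomposable⇒≡f+m : ∀ {g b} → ¬ Decomposable S g → T b → b ≢ 0 → h + b ≡ g → g ≡ f + m
      h+T≡indecomposable⇒≡f+m {g} {b} indec Tb b≢0 h+b≡g = begin
          g     ≡⟨ sym m+c≡g ⟩
          m + c ≡⟨ cong (m +_) (gap>h⇒≡f gc h<c) ⟩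
          m + f ≡⟨ +-comm m f ⟩
          f + m ∎
        where
        open ≡-Reasoning
        m<b = T-nonzero⇒m< Tb b≢0
        c = h + (b ∸ m)
        h<c : h < c
        h<c = m<m+n h (m<n⇒0<n∸m m<b)
        m+c≡g : m + c ≡ g
        m+c≡g = begin
          m + (h + (b ∸ m)) ≡⟨ sym (+-assoc m h _) ⟩
          m + h + (b ∸ m)   ≡⟨ cong (_+ (b ∸ m)) (+-comm m h) ⟩
          h + m + (b ∸ m)   ≡⟨ +-assoc h m _ ⟩
          h + (m + (b ∸ m)) ≡⟨ cong (h +_) (m+[n∸m]≡n (<⇒≤ m<b)) ⟩
          h + b             ≡⟨ h+b≡g ⟩
          g                 ∎
        gc : ¬ S c
        gc Sc = indec (m , c , Sm , m≢0 , Sc , m<n⇒n≢0 h<c , m+c≡g)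

      minimalGenerator-A : ∀ {g} → MinimalGenerator S g → g ≢ m → g ≢ f + m → MinimalGenerator T g
      minimalGenerator-A {g} (Sg , g≢0 , indec) g≢m g≢f+m = (inj₁ Sg , g≢m) , g≢0 , indec′
        where
        indec′ : ¬ Decomposable T g
        indec′ (a , b , (inj₁ Sa , _) , a≢0 , (inj₁ Sb , _) , b≢0 , a+b≡g) =
          indec (a , b , Sa , a≢0 , Sb , b≢0 , a+b≡g)
        indec′ (_ , b , (inj₂ refl , _) , _ , Tb , b≢0 , h+b≡g) =
          g≢f+m (h+T≡indecomposable⇒≡f+m indec Tb b≢0 h+b≡g)
        indec′ (a , _ , Ta@(inj₁ _ , _) , a≢0 , (inj₂ refl , _) , _ , a+h≡g) =
          g≢f+m (h+T≡indecomposable⇒≡f+m indec Ta a≢0 (trans (+-comm h a) a+h≡g))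

      minimalGenerator-h : MinimalGenerator T h
      minimalGenerator-h = (inj₂ refl , λ h≡m → <⇒≢ m<h (sym h≡m)) , m<n⇒n≢0 m<h , indec
        where
        indec : ¬ Decomposable T h
        indec (a , b , (inj₁ Sa , _) , _ , (inj₁ Sb , _) , _ , a+b≡h) = gh (subst S a+b≡h (closed a b Sa Sb))
        indec (_ , b , (inj₂ refl , _) , _ , _ , b≢0 , h+b≡h) =
          b≢0 (+-cancelˡ-≡ h b 0 (trans h+b≡h (sym (+-identityʳ h))))
        indec (a , _ , _ , a≢0 , (inj₂ refl , _) , _ , a+h≡h) = a≢0 (+-cancelʳ-≡ h a 0 a+h≡h)

      -- Every nonzero element of T exceeds m, so 2m is not a sum of two of them.
      minimalGenerator-2m : MinimalGenerator T (m + m)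
      minimalGenerator-2m = (inj₁ (closed m m Sm Sm) , m+m≢m) , m<n⇒n≢0 m<2m , indec
        where
        m<2m : m < m + m
        m<2m = m<m+n m (n≢0⇒n>0 m≢0)
        m+m≢m : m + m ≢ m
        m+m≢m = ≢-sym (<⇒≢ m<2m)
        indec : ¬ Decomposable T (m + m)
        indec (a , b , Ta , a≢0 , Tb , b≢0 , a+b≡2m) =
          <-irrefl (sym a+b≡2m) (+-mono-< (T-nonzero⇒m< Ta a≢0) (T-nonzero⇒m< Tb b≢0))

      generator-map : ℕ → ℕ
      generator-map z with z ≟ m | z ≟ f + m
      ... | yes _ | _     = m + m
      ... | no _  | yes _ = h
      ... | no _  | no _  = z

      generator-map⁻¹ : ℕ → ℕ
      generator-map⁻¹ w with w ≟ m + m | w ≟ h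
      ... | yes _ | _     = m
      ... | no _  | yes _ = f + m
      ... | no _  | no _  = w

      generator-map-minimalGenerator : ∀ {z} → MinimalGenerator S z → MinimalGenerator T (generator-map z)
      generator-map-minimalGenerator {z} gen with z ≟ m | z ≟ f + m
      ... | yes _   | _        = minimalGenerator-2m
      ... | no _    | yes _    = minimalGenerator-h
      ... | no z≢m  | no z≢f+m = minimalGenerator-A gen z≢m z≢f+m

      generator-map⁻¹-2m : generator-map⁻¹ (m + m) ≡ m
      generator-map⁻¹-2m with (m + m) ≟ (m + m)
      ... | yes _ = refl
      ... | no 2m≢2m = ⊥-elim (2m≢2m refl)

      generator-map⁻¹-h : generator-map⁻¹ h ≡ f + m
      generator-map⁻¹-h with h ≟ m + m | h ≟ h
      ... | yes h≡2m | _      = ⊥-elim (gh (subst S (sym h≡2m) (closed m m Sm Sm)))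
      ... | no _     | yes _  = refl
      ... | no _     | no h≢h = ⊥-elim (h≢h refl)

      generator-map⁻¹-S : ∀ {w} → ¬ Decomposable S w → S w → generator-map⁻¹ w ≡ w
      generator-map⁻¹-S {w} indec Sw with w ≟ m + m | w ≟ h
      ... | yes w≡2m | _       = ⊥-elim (indec (m , m , Sm , m≢0 , Sm , m≢0 , sym w≡2m))
      ... | no _     | yes w≡h = ⊥-elim (gh (subst S w≡h Sw))
      ... | no _     | no _    = refl

      generator-map⁻¹∘generator-map : ∀ {z} → MinimalGenerator S z → generator-map⁻¹ (generator-map z) ≡ z
      generator-map⁻¹∘generator-map {z} (Sz , _ , indec) with z ≟ m | z ≟ f + m
      ... | yes z≡m | _         = trans generator-map⁻¹-2m (sym z≡m)
      ... | no _    | yes z≡f+m = trans generator-map⁻¹-h (sym z≡f+m)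
      ... | no _    | no _      = generator-map⁻¹-S indec Sz

      generator-map-injective : ∀ {z z′} → MinimalGenerator S z → MinimalGenerator S z′ →
        generator-map z ≡ generator-map z′ → z ≡ z′
      generator-map-injective {z} {z′} gen gen′ eq = begin
        z                                  ≡⟨ sym (generator-map⁻¹∘generator-map gen) ⟩
        generator-map⁻¹ (generator-map z)  ≡⟨ cong generator-map⁻¹ eq ⟩
        generator-map⁻¹ (generator-map z′) ≡⟨ generator-map⁻¹∘generator-map gen′ ⟩
        z′                                 ∎
        where open ≡-Reasoning

      embeddingDimension-≤ : ∀ {eS eT} → IsEmbeddingDimension S eS → IsEmbeddingDimension T eT → eS ≤ eT
      embeddingDimension-≤ (gs , unique-gs , refl , enum-gs) (gt , _ , refl , enum-gt) =
        Unique-injection⇒length≤ generator-map unique-gs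
          (λ {z} z∈gs → proj₂ (enum-gt _) (generator-map-minimalGenerator (proj₁ (enum-gs z) z∈gs)))
          (λ {z} {z′} z∈gs z′∈gs → generator-map-injective (proj₁ (enum-gs z) z∈gs) (proj₁ (enum-gs z′) z′∈gs))

theorem4p9 : (S : Subset) → IsNumericalSemigroup S →
    (f m : ℕ) → IsFrobenius S f → IsMultiplicity S m →
    ¬ IsSpecial S f m →
    (h : ℕ) → IsMax (λ y → SpecialGap S y × y ≢ f) h →
    (∃ λ x → ¬ S x × (f ∸ m) + 1 ≤ x × x < f) →
    (eS eT : ℕ) → IsEmbeddingDimension S eS → IsEmbeddingDimension (A S h m) eT →
    eS ≤ eT
theorem4p9 S ns f m frob mult non-special h hmax (x , gx , f∸m+1≤x , x<f) eS eT dimS dimT =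
  decidable-stable (eS ≤? eT) λ eS≰eT → non-special λ (y , special-y , y≢f , m<y) →
    let m<h = <-≤-trans m<y (proj₂ hmax y (special-y , y≢f))
        f<h+m = window-gap⇒f<h+m ns frob mult hmax m<h gx (f∸m+1≤x⇒f<x+m f∸m+1≤x) x<f
    in eS≰eT (embeddingDimension-≤ ns frob mult hmax m<h f<h+m dimS dimT)
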